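{- Let $q>2$ be a prime power, $d\geq 1$, $n=d(q-1)$, and let $G=V\rtimes G_{\mathbf 0}$ where $V=F_q^d$ and $G_{\mathbf 0}=\langle x\rangle$ is cyclic of order $n$ with $x$ acting on $V$ by $v\mapsto vM_\omega$ for a generator $\omega$ of $F_q^*$. Then an element $vg\in G$, with $v\in V$ and $g\in G_{\mathbf 0}$, has order $n$ if and only if $g$ has order $n$.
   Context: $F_q$ is the field with $q$ elements and $V=F_q^d$ is the additive group of row vectors. $M_\omega$ is the $d\times d$ matrix with entries $m_{i,i+1}=1$ for $1\le i\le d-1$, $m_{d,1}=\omega$, other entries $0$. Every element of $G$ factorises uniquely as $vg$ with $v\in V$, $g\in G_{\mathbf 0}$. ($G$ is the orientation-preserving automorphism group of the Hamming map $\mathcal H(d,\omega)$.) -}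

module Defs where

open import Level using (0ℓ)
open import Algebra.Bundles using (CommutativeRing)
open import Data.Nat using () renaming (_+_ to _+ℕ_)
open import Data.Nat using (ℕ; zero; suc; _∸_; _^_; _<_; _≟_)
open import Data.Nat.DivMod using (_mod_)
open import Data.Nat.Primality using (Prime)
open import Data.Fin using (Fin; toℕ)
open import Data.Vec using (Vec; tabulate; foldr; zipWith; replicate; lookup)
open import Data.Product using (Σ; ∃; _×_; _,_)
open import Relation.Nullary using (¬_; yes; no)
open import Relation.Binary.PropositionalEquality using (_≡_)
open import Data.Empty using (⊥)

IsPrimePower : ℕ → Set
IsPrimePower q = Σ ℕ λ p → Σ ℕ λ k → Prime p × q ≡ p ^ suc k

record IsFiniteField (R : CommutativeRing 0ℓ 0ℓ) (q : ℕ) : Set where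
  open CommutativeRing R
  field
    1≉0     : ¬ (1# ≈ 0#)
    inverse : ∀ x → ¬ (x ≈ 0#) → ∃ λ y → x * y ≈ 1#
    enum      : Fin q → Carrier
    enum-surj : ∀ x → ∃ λ i → x ≈ enum i
    enum-inj  : ∀ i j → enum i ≈ enum j → i ≡ j

module _ (R : CommutativeRing 0ℓ 0ℓ) where
  open CommutativeRing R

  pow : Carrier → ℕ → Carrier
  pow x zero    = 1#
  pow x (suc k) = x * pow x k

  IsGenerator : Carrier → Set
  IsGenerator ω = ¬ (ω ≈ 0#) × (∀ y → ¬ (y ≈ 0#) → ∃ λ k → pow ω k ≈ y)

module Hamming (R : CommutativeRing 0ℓ 0ℓ) (d n : ℕ) (ω : CommutativeRing.Carrier R) where
  open CommutativeRing R

  V : Set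
  V = Vec Carrier d

  0V : V
  0V = replicate d 0#

  _+V_ : V → V → V
  _+V_ = zipWith _+_

  -- the matrix M_ω (0-indexed: m_{i,i+1} = 1, m_{d-1,0} = ω, other entries 0)
  M : Fin d → Fin d → Carrier
  M i j with toℕ j ≟ suc (toℕ i)
  ... | yes _ = 1#
  ... | no _ with toℕ i ≟ d ∸ 1 | toℕ j ≟ 0
  ...   | yes _ | yes _ = ω
  ...   | _     | _     = 0#

  _·M : V → V
  v ·M = tabulate λ j → foldr (λ _ → Carrier) _+_ 0# (tabulate λ i → lookup v i * M i j)

  act : ℕ → V → V
  act zero    v = v
  act (suc k) v = act k v ·M

  -- G₀ = ⟨x⟩ ≅ ℤ/n, the element x^a represented by a : Fin n
  _⊕_ : Fin n → Fin n → Fin n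
  a ⊕ b = addMod a b
    where
    addMod : ∀ {m} → Fin m → Fin m → Fin m
    addMod {suc m} a b = (toℕ a +ℕ toℕ b) mod suc m

  -- elements v g of G, written as pairs (v , a) meaning v x^a
  G : Set
  G = V × Fin n

  -- (v x^a)(w x^b) = (v + w M^a) x^(a+b), since x^a w x^(-a) = w M^a
  _∙_ : G → G → G
  (v , a) ∙ (w , b) = (v +V act (toℕ a) w) , (a ⊕ b)

  IsId : G → Set
  IsId (v , a) = Pointwise v × toℕ a ≡ 0
    where
    Pointwise : ∀ {m} → Vec Carrier m → Set
    Pointwise u = ∀ i → lookup u i ≈ 0#

  -- powSuc g m = g^(m+1)
  powSuc : G → ℕ → G
  powSuc g zero    = g
  powSuc g (suc m) = g ∙ powSuc g m

  HasOrder : ℕ → G → Set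
  HasOrder zero    g = ⊥
  HasOrder (suc m) g = IsId (powSuc g m) × (∀ j → j < m → ¬ IsId (powSuc g j))

-- Write (v x^a)^N = (S_N , N a) with S_N = v + v M^a + ⋯ + v M^((N-1)a). Since M_ω^d = ω I and
-- ω has order q - 1, M^k = I whenever n ∣ k, so (v x^a)^N = 1 iff n ∣ N a and S_N = 0; in
-- particular the order of v x^a is at least that of x^a.
--
-- If x^a has order n then ω^a ≠ 1 (otherwise q - 1 ∣ a and (x^a)^d = 1 with d < n). Now S_n is
-- fixed by M^a, hence by M^(ad) = ω^a I, so S_n = 0 and v x^a has order n.
--
-- Conversely, let N₀ < n be the order of x^a while v x^a has order n. Then Y = S_N₀ ≠ 0 is fixed
-- by M^a, which forces ω^a = 1, so n ∣ d a and N₀ ∣ d, say d = Q N₀. As (v x^a)^(k N₀) = (k Y , 1)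
-- and n = Q (q - 1) N₀, the additive order of 1 in F is c = Q (q - 1). But c ≤ q, and c < q forces
-- 2c ≤ q (translate the multiples of 1 by a non-multiple); for q > 2 both are impossible.

module Submission where

open import Defs
open import Level using (0ℓ)
open import Algebra.Bundles using (CommutativeRing; Monoid)
open import Data.Nat as ℕ using (ℕ; zero; suc; _<_; _≤_; z≤n; s≤s; NonZero; _%_; _/_)
import Data.Nat.Properties as ℕ
open import Data.Nat.DivMod using (_mod_; m≡m%n+[m/n]*n; m%n<n)
open import Data.Nat.Divisibility using (_∣_; divides; m%n≡0⇒n∣m; ∣m+n∣m⇒∣n; ∣n⇒∣m*n; *-monoʳ-∣; m∣m*n; _∣?_)
open import Data.Fin as Fin using (Fin; toℕ; fromℕ; inject₁; punchOut)
import Data.Fin.Properties as Fin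
open import Data.Vec as Vec using (Vec; lookup; tabulate; foldr)
import Data.Vec.Properties as Vec
open import Data.Vec.Relation.Binary.Pointwise.Extensional as Pointwise using (Pointwise; ext)
open import Data.Product using (∃; _×_; _,_; proj₁; proj₂)
open import Data.Sum using (_⊎_; inj₁; inj₂; [_,_]′)
open import Relation.Nullary using (¬_; Dec; yes; no)
open import Relation.Nullary.Decidable using (decidable-stable)
open import Relation.Binary.Bundles using (Setoid)
open import Relation.Binary.Definitions using (Decidable)
open import Relation.Binary.PropositionalEquality as ≡ using (_≡_; _≢_)
import Relation.Binary.Reasoning.Setoid
open import Data.Empty using (⊥; ⊥-elim)
open import Function using (_∘_)
open import Function.Bundles using (_⇔_; mk⇔; Equivalence)

IsLeast : (ℕ → Set) → ℕ → Set
IsLeast P m = P m × (∀ k → k < m → ¬ P k)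

module _ {P : ℕ → Set} (P? : ∀ m → Dec (P m)) where
  searchLeast : ∀ j → (∃ λ m → m ≤ j × IsLeast P m) ⊎ (∀ k → k ≤ j → ¬ P k)
  searchLeast zero with P? 0
  ... | yes p0 = inj₁ (0 , z≤n , p0 , λ _ ())
  ... | no ¬p0 = inj₂ λ { zero _ → ¬p0 }
  searchLeast (suc j) with searchLeast j
  ... | inj₁ (m , m≤j , least) = inj₁ (m , ℕ.m≤n⇒m≤1+n m≤j , least)
  ... | inj₂ none with P? (suc j)
  ...   | yes p = inj₁ (suc j , ℕ.≤-refl , p , λ k k<1+j → none k (ℕ.≤-pred k<1+j))
  ...   | no ¬p = inj₂ λ k k≤1+j → [ none k ∘ ℕ.≤-pred , (λ { ≡.refl → ¬p }) ]′ (ℕ.m≤n⇒m<n∨m≡n k≤1+j)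

  leastWitness : ∀ {j} → P j → ∃ λ m → m ≤ j × IsLeast P m
  leastWitness {j} p = [ (λ w → w) , (λ none → ⊥-elim (none j ℕ.≤-refl p)) ]′ (searchLeast j)

leastPeriod-∣ : ∀ {n a m N} → IsLeast (λ k → n ∣ suc k ℕ.* a) m → n ∣ N ℕ.* a → suc m ∣ N
leastPeriod-∣ {n} {a} {m} {N} (n∣[1+m]a , least) n∣Na with N % suc m in N%[1+m]≡r
... | zero  = m%n≡0⇒n∣m N (suc m) N%[1+m]≡r
... | suc r = ⊥-elim (least r r<m (≡.subst (λ r → n ∣ r ℕ.* a) N%[1+m]≡r n∣ra))
  where
  r<m : r < m
  r<m = ℕ.≤-pred (≡.subst (_< suc m) N%[1+m]≡r (m%n<n N (suc m)))
  t : ℕ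
  t = N / suc m
  Na≡t[1+m]a+ra : N ℕ.* a ≡ t ℕ.* (suc m ℕ.* a) ℕ.+ (N % suc m) ℕ.* a
  Na≡t[1+m]a+ra = ≡.trans (≡.cong (ℕ._* a) (≡.trans (m≡m%n+[m/n]*n N (suc m)) (ℕ.+-comm (N % suc m) _)))
    (≡.trans (ℕ.*-distribʳ-+ a (t ℕ.* suc m) (N % suc m)) (≡.cong (ℕ._+ (N % suc m) ℕ.* a) (ℕ.*-assoc t (suc m) a)))
  n∣ra : n ∣ (N % suc m) ℕ.* a
  n∣ra = ∣m+n∣m⇒∣n (≡.subst (n ∣_) Na≡t[1+m]a+ra n∣Na) (∣n⇒∣m*n t n∣[1+m]a)

1+m<m+m : ∀ {m} → 2 ≤ m → suc m < m ℕ.+ m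
1+m<m+m {m} 2≤m = ℕ.≤-trans (ℕ.≤-reflexive (ℕ.+-comm 2 m)) (ℕ.+-monoʳ-≤ m 2≤m)

module MonoidMultiples {a ℓ} (M : Monoid a ℓ) where
  open Monoid M
  open import Algebra.Properties.Monoid.Mult M renaming (_×_ to _·_)
  open import Relation.Binary.Reasoning.Setoid setoid

  ·-ε : ∀ t → t · ε ≈ ε
  ·-ε zero    = refl
  ·-ε (suc t) = trans (identityˡ _) (·-ε t)

  ·-reduce : ∀ c .{{_ : NonZero c}} {y} → c · y ≈ ε → ∀ m → m · y ≈ (m % c) · y
  ·-reduce c {y} c·y≈ε m = begin
    m · y                                ≡⟨ ≡.cong (_· y) (m≡m%n+[m/n]*n m c) ⟩
    (m % c ℕ.+ (m / c) ℕ.* c) · y        ≈⟨ ×-homo-+ y (m % c) _ ⟩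
    (m % c) · y ∙ ((m / c) ℕ.* c) · y    ≈⟨ ∙-congˡ (sym (×-assocˡ y (m / c) c)) ⟩
    (m % c) · y ∙ (m / c) · (c · y)      ≈⟨ ∙-congˡ (trans (×-congʳ (m / c) c·y≈ε) (·-ε (m / c))) ⟩
    (m % c) · y ∙ ε                      ≈⟨ identityʳ _ ⟩
    (m % c) · y                          ∎

module FiniteFieldProperties (F : CommutativeRing 0ℓ 0ℓ) {q-1 : ℕ} (isFF : IsFiniteField F (suc q-1)) where
  open CommutativeRing F
  open IsFiniteField isFF
  open import Relation.Binary.Reasoning.Setoid setoid
  open import Algebra.Properties.Group +-group using (∙-cancelˡ; x∙y⁻¹≈ε⇒x≈y)
  open import Algebra.Properties.Semiring.Exp semiring using (_^_; ^-homo-*)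
  open import Algebra.Properties.Semiring.Mult semiring using (×-homo-+; ×-congʳ; ×-assoc-*) renaming (_×_ to _·_)

  q : ℕ
  q = suc q-1

  index : Carrier → Fin q
  index x = proj₁ (enum-surj x)

  index-cong : ∀ {x y} → x ≈ y → index x ≡ index y
  index-cong {x} {y} x≈y =
    enum-inj _ _ (trans (sym (proj₂ (enum-surj x))) (trans x≈y (proj₂ (enum-surj y))))

  index-injective : ∀ {x y} → index x ≡ index y → x ≈ y
  index-injective {x} {y} eq =
    trans (proj₂ (enum-surj x)) (trans (reflexive (≡.cong enum eq)) (sym (proj₂ (enum-surj y))))

  infix 4 _≈?_
  _≈?_ : Decidable _≈_
  x ≈? y with index x Fin.≟ index y
  ... | yes eq = yes (index-injective eq)
  ... | no neq = no (λ x≈y → neq (index-cong x≈y))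

  injection⇒≤q : ∀ {m} (f : Fin m → Carrier) → (∀ {i j} → f i ≈ f j → i ≡ j) → m ≤ q
  injection⇒≤q f inj = Fin.injective⇒≤ (λ eq → inj (index-injective eq))

  *-cancelˡ : ∀ {x y z} → ¬ x ≈ 0# → x * y ≈ x * z → y ≈ z
  *-cancelˡ {x} {y} {z} x≉0 xy≈xz with inverse x x≉0
  ... | x⁻¹ , xx⁻¹≈1 = begin
    y                ≈⟨ sym (*-identityˡ y) ⟩
    1# * y           ≈⟨ *-congʳ (trans (sym xx⁻¹≈1) (*-comm x x⁻¹)) ⟩
    (x⁻¹ * x) * y    ≈⟨ *-assoc x⁻¹ x y ⟩
    x⁻¹ * (x * y)    ≈⟨ *-congˡ xy≈xz ⟩
    x⁻¹ * (x * z)    ≈⟨ sym (*-assoc x⁻¹ x z) ⟩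
    (x⁻¹ * x) * z    ≈⟨ *-congʳ (trans (*-comm x⁻¹ x) xx⁻¹≈1) ⟩
    1# * z           ≈⟨ *-identityˡ z ⟩
    z                ∎

  x*y≈0⇒y≈0 : ∀ {x y} → ¬ x ≈ 0# → x * y ≈ 0# → y ≈ 0#
  x*y≈0⇒y≈0 {x} x≉0 xy≈0 = *-cancelˡ x≉0 (trans xy≈0 (sym (zeroʳ x)))

  fixedBy≉1⇒≈0 : ∀ {x y} → ¬ x ≈ 1# → x * y ≈ y → y ≈ 0#
  fixedBy≉1⇒≈0 {x} {y} x≉1 xy≈y = x*y≈0⇒y≈0 x-1≉0 (begin
    (x - 1#) * y      ≈⟨ distribʳ y x (- 1#) ⟩
    x * y + - 1# * y  ≈⟨ +-cong xy≈y (-1*x≈-x y) ⟩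
    y - y             ≈⟨ -‿inverseʳ y ⟩
    0#                ∎)
    where
    open import Algebra.Properties.Ring ring using (-1*x≈-x)
    x-1≉0 : ¬ x - 1# ≈ 0#
    x-1≉0 = x≉1 ∘ x∙y⁻¹≈ε⇒x≈y x 1#

  instance
    q-1-nonZero : NonZero q-1
    q-1-nonZero = ℕ.≢-nonZero λ q-1≡0 → 1≉0 (index-injective (Fin.toℕ-injective
      (≡.trans (index≡0 q-1≡0 1#) (≡.sym (index≡0 q-1≡0 0#)))))
      where
      index≡0 : q-1 ≡ 0 → ∀ x → toℕ (index x) ≡ 0
      index≡0 q-1≡0 x = ℕ.n<1⇒n≡0 (≡.subst (λ m → toℕ (index x) < suc m) q-1≡0 (Fin.toℕ<n (index x)))

  pow≡^ : ∀ x k → pow F x k ≡ x ^ k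
  pow≡^ x zero    = ≡.refl
  pow≡^ x (suc k) = ≡.cong (x *_) (pow≡^ x k)

  module Generator {ω : Carrier} (gen : IsGenerator F ω) where
    open MonoidMultiples *-monoid using () renaming (·-reduce to ^-reduce)

    ω≉0 : ¬ ω ≈ 0#
    ω≉0 = proj₁ gen

    log : ∀ y → ¬ y ≈ 0# → ℕ
    log y y≉0 = proj₁ (proj₂ gen y y≉0)

    ω^log : ∀ y (y≉0 : ¬ y ≈ 0#) → ω ^ log y y≉0 ≈ y
    ω^log y y≉0 = trans (reflexive (≡.sym (pow≡^ ω (log y y≉0)))) (proj₂ (proj₂ gen y y≉0))

    ω^≉0 : ∀ k → ¬ ω ^ k ≈ 0#
    ω^≉0 zero    = 1≉0
    ω^≉0 (suc k) = ω^≉0 k ∘ x*y≈0⇒y≈0 ω≉0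

    period-minimal : ∀ r .{{_ : NonZero r}} → ω ^ r ≈ 1# → q-1 ≤ r
    period-minimal r ω^r≈1 = ℕ.≤-pred (Fin.injective⇒≤ {f = encode ∘ enum}
      λ {i} {j} eq → enum-inj i j (begin
        enum i                  ≈⟨ sym (decode-encode (enum i)) ⟩
        decode (encode (enum i)) ≡⟨ ≡.cong decode eq ⟩
        decode (encode (enum j)) ≈⟨ decode-encode (enum j) ⟩
        enum j                  ∎))
      where
      encode : Carrier → Fin (suc r)
      encode x with x ≈? 0#
      ... | yes _   = Fin.zero
      ... | no x≉0 = Fin.suc (log x x≉0 mod r)

      decode : Fin (suc r) → Carrier
      decode Fin.zero    = 0#
      decode (Fin.suc i) = ω ^ toℕ i

      decode-encode : ∀ x → decode (encode x) ≈ x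
      decode-encode x with x ≈? 0#
      ... | yes x≈0 = sym x≈0
      ... | no x≉0 = begin
        ω ^ toℕ (log x x≉0 mod r)  ≡⟨ ≡.cong (ω ^_) (Fin.toℕ-fromℕ< (m%n<n (log x x≉0) r)) ⟩
        ω ^ (log x x≉0 % r)        ≈⟨ sym (^-reduce r ω^r≈1 (log x x≉0)) ⟩
        ω ^ log x x≉0              ≈⟨ ω^log x x≉0 ⟩
        x                          ∎

    ω^i≈ω^j⇒ω^[j∸i]≈1 : ∀ {i j} → i ≤ j → ω ^ i ≈ ω ^ j → ω ^ (j ℕ.∸ i) ≈ 1#
    ω^i≈ω^j⇒ω^[j∸i]≈1 {i} {j} i≤j ω^i≈ω^j = *-cancelˡ (ω^≉0 i) (begin
      ω ^ i * ω ^ (j ℕ.∸ i)  ≈⟨ sym (^-homo-* ω i (j ℕ.∸ i)) ⟩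
      ω ^ (i ℕ.+ (j ℕ.∸ i))  ≡⟨ ≡.cong (ω ^_) (ℕ.m+[n∸m]≡n i≤j) ⟩
      ω ^ j                  ≈⟨ sym ω^i≈ω^j ⟩
      ω ^ i                  ≈⟨ sym (*-identityʳ _) ⟩
      ω ^ i * 1#             ∎)

    index0≢index[ω^] : ∀ k → index 0# ≢ index (ω ^ k)
    index0≢index[ω^] k eq = ω^≉0 k (sym (index-injective eq))

    -- Among the q powers ω^0, …, ω^(q-1), all nonzero, two must coincide.
    ω^[q-1]≈1 : ω ^ q-1 ≈ 1#
    ω^[q-1]≈1 with Fin.pigeonhole (ℕ.n<1+n q-1) (λ i → punchOut (index0≢index[ω^] (toℕ i)))
    ... | i , j , i<j , eq = ≡.subst (λ t → ω ^ t ≈ 1#) t≡q-1 ω^t≈1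
      where
      t : ℕ
      t = toℕ j ℕ.∸ toℕ i
      ω^t≈1 : ω ^ t ≈ 1#
      ω^t≈1 = ω^i≈ω^j⇒ω^[j∸i]≈1 (ℕ.<⇒≤ i<j)
        (index-injective (Fin.punchOut-injective (index0≢index[ω^] (toℕ i)) (index0≢index[ω^] (toℕ j)) eq))
      t≡q-1 : t ≡ q-1
      t≡q-1 = ℕ.≤-antisym
        (ℕ.≤-pred (ℕ.≤-trans (s≤s (ℕ.m∸n≤m (toℕ j) (toℕ i))) (Fin.toℕ<n j)))
        (period-minimal t {{ℕ.>-nonZero (ℕ.m<n⇒0<n∸m i<j)}} ω^t≈1)

    ω^k≈1⇒q-1∣k : ∀ k → ω ^ k ≈ 1# → q-1 ∣ k
    ω^k≈1⇒q-1∣k k ω^k≈1 with k % q-1 in k%q-1≡r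
    ... | zero  = m%n≡0⇒n∣m k q-1 k%q-1≡r
    ... | suc r = ⊥-elim (ℕ.<⇒≱ r<q-1 (period-minimal (suc r) ω^r≈1))
      where
      r<q-1 : suc r < q-1
      r<q-1 = ≡.subst (_< q-1) k%q-1≡r (m%n<n k q-1)
      ω^r≈1 : ω ^ suc r ≈ 1#
      ω^r≈1 = begin
        ω ^ suc r     ≡⟨ ≡.cong (ω ^_) k%q-1≡r ⟨
        ω ^ (k % q-1) ≈⟨ ^-reduce q-1 ω^[q-1]≈1 k ⟨
        ω ^ k         ≈⟨ ω^k≈1 ⟩
        1#            ∎

  ·≈·1* : ∀ k y → k · y ≈ (k · 1#) * y
  ·≈·1* k y = sym (trans (×-assoc-* k 1# y) (×-congʳ k (*-identityˡ y)))

  ·1≈0⇒·≈0 : ∀ k → k · 1# ≈ 0# → ∀ y → k · y ≈ 0#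
  ·1≈0⇒·≈0 k k·1≈0 y = trans (·≈·1* k y) (trans (*-congʳ k·1≈0) (zeroˡ y))

  ·≈0⇒·1≈0 : ∀ k {y} → ¬ y ≈ 0# → k · y ≈ 0# → k · 1# ≈ 0#
  ·≈0⇒·1≈0 k {y} y≉0 k·y≈0 = x*y≈0⇒y≈0 y≉0 (trans (*-comm y _) (trans (sym (·≈·1* k y)) k·y≈0))

  module AdditiveOrderOfOne {c : ℕ} (c·1≈0 : c · 1# ≈ 0#)
                            (c-least : ∀ k → 0 < k → k < c → ¬ k · 1# ≈ 0#) where
    open MonoidMultiples +-monoid using (·-reduce)

    ·1-injective-≤ : ∀ {k k′} → k ≤ k′ → k′ < c → k · 1# ≈ k′ · 1# → k ≡ k′
    ·1-injective-≤ {k} k≤k′ k′<c eq with ℕ.m≤n⇒∃[o]m+o≡n k≤k′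
    ... | zero  , ≡.refl = ≡.sym (ℕ.+-identityʳ k)
    ... | suc t , ≡.refl = ⊥-elim (c-least (suc t) (s≤s z≤n) t<c (∙-cancelˡ (k · 1#) _ _ (begin
      k · 1# + suc t · 1#  ≈⟨ ×-homo-+ 1# k (suc t) ⟨
      (k ℕ.+ suc t) · 1#   ≈⟨ eq ⟨
      k · 1#               ≈⟨ +-identityʳ _ ⟨
      k · 1# + 0#          ∎)))
      where
      t<c : suc t < c
      t<c = ℕ.≤-<-trans (ℕ.m≤n+m (suc t) k) k′<c

    ·1-injective : ∀ {k k′} → k < c → k′ < c → k · 1# ≈ k′ · 1# → k ≡ k′
    ·1-injective {k} {k′} k<c k′<c eq with ℕ.≤-total k k′
    ... | inj₁ k≤k′ = ·1-injective-≤ k≤k′ k′<c eq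
    ... | inj₂ k′≤k = ≡.sym (·1-injective-≤ k′≤k k<c (sym eq))

    additiveOrder≤q : c ≤ q
    additiveOrder≤q = injection⇒≤q (λ k → toℕ k · 1#)
      (λ eq → Fin.toℕ-injective (·1-injective (Fin.toℕ<n _) (Fin.toℕ<n _) eq))

    IsMultipleOfOne : Carrier → Set
    IsMultipleOfOne x = ∃ λ (k : Fin c) → x ≈ toℕ k · 1#

    nonMultipleOfOne : c < q → ∃ λ (i : Fin q) → ¬ IsMultipleOfOne (enum i)
    nonMultipleOfOne c<q = Fin.¬∀⟶∃¬ q _ (λ i → Fin.any? (λ k → enum i ≈? toℕ k · 1#)) allMultiples⇒q≤c
      where
      allMultiples⇒q≤c : ¬ (∀ i → IsMultipleOfOne (enum i))
      allMultiples⇒q≤c multiple = ℕ.<⇒≱ c<q (Fin.injective⇒≤ {f = proj₁ ∘ multiple} λ {i} {j} eq →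
        enum-inj i j (trans (proj₂ (multiple i))
          (trans (reflexive (≡.cong (λ k → toℕ k · 1#) eq)) (sym (proj₂ (multiple j))))))

    -- Translating the c multiples of 1 by a non-multiple gives c further distinct elements.
    additiveOrder<q⇒2c≤q : c < q → c ℕ.+ c ≤ q
    additiveOrder<q⇒2c≤q c<q = injection⇒≤q (coset ∘ Fin.splitAt c) λ {z} {z′} eq →
      ≡.trans (≡.sym (Fin.join-splitAt c c z))
        (≡.trans (≡.cong (Fin.join c c) (coset-injective {Fin.splitAt c z} {Fin.splitAt c z′} eq)) (Fin.join-splitAt c c z′))
      where
      x : Carrier
      x = enum (proj₁ (nonMultipleOfOne c<q))

      coset : Fin c ⊎ Fin c → Carrier
      coset = [ (λ k → toℕ k · 1#) , (λ k → x + toℕ k · 1#) ]′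

      notInBoth : ∀ {k k′} → k < c → k′ < c → ¬ k · 1# ≈ x + k′ · 1#
      notInBoth {k} {k′} k<c k′<c eq = proj₂ (nonMultipleOfOne c<q) (m mod c , (begin
        x                                 ≈⟨ +-identityʳ x ⟨
        x + 0#                            ≈⟨ +-congˡ c·1≈0 ⟨
        x + c · 1#                        ≡⟨ ≡.cong (λ m → x + m · 1#) (ℕ.m+[n∸m]≡n (ℕ.<⇒≤ k′<c)) ⟨
        x + (k′ ℕ.+ (c ℕ.∸ k′)) · 1#      ≈⟨ +-congˡ (×-homo-+ 1# k′ (c ℕ.∸ k′)) ⟩
        x + (k′ · 1# + (c ℕ.∸ k′) · 1#)   ≈⟨ +-assoc _ _ _ ⟨
        (x + k′ · 1#) + (c ℕ.∸ k′) · 1#   ≈⟨ +-congʳ eq ⟨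
        k · 1# + (c ℕ.∸ k′) · 1#          ≈⟨ ×-homo-+ 1# k (c ℕ.∸ k′) ⟨
        m · 1#                            ≈⟨ ·-reduce c c·1≈0 m ⟩
        (m % c) · 1#                      ≡⟨ ≡.cong (_· 1#) (Fin.toℕ-fromℕ< (m%n<n m c)) ⟨
        toℕ (m mod c) · 1#                ∎))
        where
        instance
          c-nonZero : NonZero c
          c-nonZero = ℕ.>-nonZero (ℕ.≤-<-trans z≤n k<c)
        m : ℕ
        m = k ℕ.+ (c ℕ.∸ k′)

      coset-injective : ∀ {s s′} → coset s ≈ coset s′ → s ≡ s′
      coset-injective {inj₁ k} {inj₁ k′} eq =
        ≡.cong inj₁ (Fin.toℕ-injective (·1-injective (Fin.toℕ<n k) (Fin.toℕ<n k′) eq))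
      coset-injective {inj₂ k} {inj₂ k′} eq =
        ≡.cong inj₂ (Fin.toℕ-injective (·1-injective (Fin.toℕ<n k) (Fin.toℕ<n k′) (∙-cancelˡ x _ _ eq)))
      coset-injective {inj₁ k} {inj₂ k′} eq = ⊥-elim (notInBoth (Fin.toℕ<n k) (Fin.toℕ<n k′) eq)
      coset-injective {inj₂ k} {inj₁ k′} eq = ⊥-elim (notInBoth (Fin.toℕ<n k′) (Fin.toℕ<n k) (sym eq))

    additiveOrder≢[1+Q]*[q-1] : 2 ≤ q-1 → ∀ Q → c ≢ suc Q ℕ.* q-1
    additiveOrder≢[1+Q]*[q-1] 2≤q-1 zero c≡q-1+0 = ℕ.<⇒≱ (1+m<m+m 2≤q-1) (≡.subst (λ m → m ℕ.+ m ≤ q) c≡q-1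
      (additiveOrder<q⇒2c≤q (s≤s (ℕ.≤-reflexive c≡q-1))))
      where
      c≡q-1 : c ≡ q-1
      c≡q-1 = ≡.trans c≡q-1+0 (ℕ.+-identityʳ q-1)
    additiveOrder≢[1+Q]*[q-1] 2≤q-1 (suc Q) c≡[2+Q]*[q-1] = ℕ.<⇒≱ q<c additiveOrder≤q
      where
      q<c : q < c
      q<c = ℕ.<-≤-trans (1+m<m+m 2≤q-1) (ℕ.≤-trans (ℕ.+-monoʳ-≤ q-1 (ℕ.m≤m+n q-1 (Q ℕ.* q-1)))
        (ℕ.≤-reflexive (≡.sym c≡[2+Q]*[q-1])))

module HammingAction (F : CommutativeRing 0ℓ 0ℓ) (d-1 n-1 : ℕ) (ω : CommutativeRing.Carrier F) where
  open CommutativeRing F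
  open import Relation.Binary.Reasoning.Setoid setoid
  open import Algebra.Properties.Group +-group using (∙-cancelˡ)

  d n : ℕ
  d = suc d-1
  n = suc n-1

  open Hamming F d n ω

  infix 4 _≋_
  _≋_ : V → V → Set
  _≋_ = Pointwise _≈_

  ≋-setoid : Setoid 0ℓ 0ℓ
  ≋-setoid = record { isEquivalence = Pointwise.isEquivalence {n = d} isEquivalence }

  module ≋ = Setoid ≋-setoid
  module ≋-Reasoning = Relation.Binary.Reasoning.Setoid ≋-setoid

  infixr 7 _*V_
  _*V_ : Carrier → V → V
  c *V v = Vec.map (c *_) v

  lookup-+V : ∀ u w j → lookup (u +V w) j ≡ lookup u j + lookup w j
  lookup-+V u w j = Vec.lookup-zipWith _+_ j u w

  lookup-*V : ∀ c u j → lookup (c *V u) j ≡ c * lookup u j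
  lookup-*V c u j = Vec.lookup-map j (c *_) u

  lookup-0V : ∀ j → lookup 0V j ≡ 0#
  lookup-0V j = Vec.lookup-replicate j 0#

  *V-cong : ∀ {c c′ u w} → c ≈ c′ → u ≋ w → c *V u ≋ c′ *V w
  *V-cong {c} {c′} {u} {w} c≈c′ (ext u≈w) = ext λ j → begin
    lookup (c *V u) j   ≡⟨ lookup-*V c u j ⟩
    c * lookup u j      ≈⟨ *-cong c≈c′ (u≈w j) ⟩
    c′ * lookup w j     ≡⟨ lookup-*V c′ w j ⟨
    lookup (c′ *V w) j  ∎

  *V-assoc : ∀ c c′ u → c *V (c′ *V u) ≋ (c * c′) *V u
  *V-assoc c c′ u = ext λ j → begin
    lookup (c *V (c′ *V u)) j  ≡⟨ ≡.trans (lookup-*V c (c′ *V u) j) (≡.cong (c *_) (lookup-*V c′ u j)) ⟩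
    c * (c′ * lookup u j)      ≈⟨ *-assoc c c′ _ ⟨
    (c * c′) * lookup u j      ≡⟨ lookup-*V (c * c′) u j ⟨
    lookup ((c * c′) *V u) j   ∎

  *V-identityˡ : ∀ v → 1# *V v ≋ v
  *V-identityˡ v = ext λ j → trans (reflexive (lookup-*V 1# v j)) (*-identityˡ _)

  +V-cong : ∀ {u u′ w w′} → u ≋ u′ → w ≋ w′ → u +V w ≋ u′ +V w′
  +V-cong {u} {u′} {w} {w′} (ext u≈u′) (ext w≈w′) = ext λ j → begin
    lookup (u +V w) j         ≡⟨ lookup-+V u w j ⟩
    lookup u j + lookup w j   ≈⟨ +-cong (u≈u′ j) (w≈w′ j) ⟩
    lookup u′ j + lookup w′ j ≡⟨ lookup-+V u′ w′ j ⟨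
    lookup (u′ +V w′) j       ∎

  +V-assoc : ∀ u v w → (u +V v) +V w ≋ u +V (v +V w)
  +V-assoc u v w = ext λ j → begin
    lookup ((u +V v) +V w) j                 ≡⟨ ≡.trans (lookup-+V (u +V v) w j) (≡.cong (_+ lookup w j) (lookup-+V u v j)) ⟩
    (lookup u j + lookup v j) + lookup w j   ≈⟨ +-assoc _ _ _ ⟩
    lookup u j + (lookup v j + lookup w j)   ≡⟨ ≡.trans (lookup-+V u (v +V w) j) (≡.cong (lookup u j +_) (lookup-+V v w j)) ⟨
    lookup (u +V (v +V w)) j                 ∎

  +V-comm : ∀ u w → u +V w ≋ w +V u
  +V-comm u w = ext λ j → begin
    lookup (u +V w) j       ≡⟨ lookup-+V u w j ⟩
    lookup u j + lookup w j ≈⟨ +-comm _ _ ⟩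
    lookup w j + lookup u j ≡⟨ lookup-+V w u j ⟨
    lookup (w +V u) j       ∎

  +V-identityʳ : ∀ u → u +V 0V ≋ u
  +V-identityʳ u = ext λ j → begin
    lookup (u +V 0V) j       ≡⟨ lookup-+V u 0V j ⟩
    lookup u j + lookup 0V j ≡⟨ ≡.cong (lookup u j +_) (lookup-0V j) ⟩
    lookup u j + 0#          ≈⟨ +-identityʳ _ ⟩
    lookup u j               ∎

  +V-identityˡ : ∀ u → 0V +V u ≋ u
  +V-identityˡ u = ≋.trans (+V-comm 0V u) (+V-identityʳ u)

  +V-cancelˡ : ∀ u v w → u +V v ≋ u +V w → v ≋ w
  +V-cancelˡ u v w (ext u+v≈u+w) = ext λ j → ∙-cancelˡ (lookup u j) _ _ (begin
    lookup u j + lookup v j ≡⟨ lookup-+V u v j ⟨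
    lookup (u +V v) j       ≈⟨ u+v≈u+w j ⟩
    lookup (u +V w) j       ≡⟨ lookup-+V u w j ⟩
    lookup u j + lookup w j ∎)

  sum-single : ∀ {m} (f : Fin m → Carrier) i → (∀ k → k ≢ i → f k ≈ 0#) →
               foldr (λ _ → Carrier) _+_ 0# (tabulate f) ≈ f i
  sum-single {suc m} f Fin.zero    f≈0 = trans (+-congˡ (sum-zero (λ k → f≈0 (Fin.suc k) λ ()))) (+-identityʳ _)
    where
    sum-zero : ∀ {m} {g : Fin m → Carrier} → (∀ k → g k ≈ 0#) → foldr (λ _ → Carrier) _+_ 0# (tabulate g) ≈ 0#
    sum-zero {zero}  g≈0 = refl
    sum-zero {suc m} g≈0 = trans (+-cong (g≈0 Fin.zero) (sum-zero (g≈0 ∘ Fin.suc))) (+-identityʳ 0#)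
  sum-single {suc m} f (Fin.suc i) f≈0 = trans (+-congʳ (f≈0 Fin.zero λ ()))
    (trans (+-identityˡ _) (sum-single (f ∘ Fin.suc) i λ k k≢i → f≈0 (Fin.suc k) (k≢i ∘ Fin.suc-injective)))

  -- Column j of M_ω has a single nonzero entry, weight j, in row source j.
  source : Fin d → Fin d
  source Fin.zero    = fromℕ d-1
  source (Fin.suc j) = inject₁ j

  weight : Fin d → Carrier
  weight Fin.zero    = ω
  weight (Fin.suc j) = 1#

  M-source : ∀ j → M (source j) j ≡ weight j
  M-source Fin.zero with toℕ (fromℕ d-1) ℕ.≟ d-1
  ... | yes _ = ≡.refl
  ... | no ≢ = ⊥-elim (≢ (Fin.toℕ-fromℕ d-1))
  M-source (Fin.suc j) with suc (toℕ j) ℕ.≟ suc (toℕ (inject₁ j))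
  ... | yes _ = ≡.refl
  ... | no ≢ = ⊥-elim (≢ (≡.cong suc (≡.sym (Fin.toℕ-inject₁ j))))

  M-off-source : ∀ i j → i ≢ source j → M i j ≡ 0#
  M-off-source i Fin.zero i≢ with toℕ i ℕ.≟ d-1
  ... | yes eq = ⊥-elim (i≢ (Fin.toℕ-injective (≡.trans eq (≡.sym (Fin.toℕ-fromℕ d-1)))))
  ... | no _ = ≡.refl
  M-off-source i (Fin.suc j) i≢ with suc (toℕ j) ℕ.≟ suc (toℕ i)
  ... | yes eq = ⊥-elim (i≢ (Fin.toℕ-injective (≡.trans (ℕ.suc-injective (≡.sym eq)) (≡.sym (Fin.toℕ-inject₁ j)))))
  ... | no _ with toℕ i ℕ.≟ d-1
  ...   | yes _ = ≡.refl
  ...   | no _ = ≡.refl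

  lookup-·M : ∀ v j → lookup (v ·M) j ≈ weight j * lookup v (source j)
  lookup-·M v j = begin
    lookup (v ·M) j
      ≡⟨ Vec.lookup∘tabulate (λ j → foldr (λ _ → Carrier) _+_ 0# (tabulate λ i → lookup v i * M i j)) j ⟩
    foldr (λ _ → Carrier) _+_ 0# (tabulate λ i → lookup v i * M i j)
      ≈⟨ sum-single (λ i → lookup v i * M i j) (source j) off-source≈0 ⟩
    lookup v (source j) * M (source j) j
      ≡⟨ ≡.cong (lookup v (source j) *_) (M-source j) ⟩
    lookup v (source j) * weight j
      ≈⟨ *-comm _ _ ⟩
    weight j * lookup v (source j)
      ∎
    where
    off-source≈0 : ∀ i → i ≢ source j → lookup v i * M i j ≈ 0#
    off-source≈0 i i≢ = trans (reflexive (≡.cong (lookup v i *_) (M-off-source i j i≢))) (zeroʳ _)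

  ·M-cong : ∀ {u w} → u ≋ w → u ·M ≋ w ·M
  ·M-cong {u} {w} (ext u≈w) = ext λ j → begin
    lookup (u ·M) j                  ≈⟨ lookup-·M u j ⟩
    weight j * lookup u (source j)   ≈⟨ *-congˡ (u≈w (source j)) ⟩
    weight j * lookup w (source j)   ≈⟨ lookup-·M w j ⟨
    lookup (w ·M) j                  ∎

  ·M-+V : ∀ u w → (u +V w) ·M ≋ (u ·M) +V (w ·M)
  ·M-+V u w = ext λ j → begin
    lookup ((u +V w) ·M) j                                         ≈⟨ lookup-·M (u +V w) j ⟩
    weight j * lookup (u +V w) (source j)                          ≡⟨ ≡.cong (weight j *_) (lookup-+V u w (source j)) ⟩
    weight j * (lookup u (source j) + lookup w (source j))         ≈⟨ distribˡ _ _ _ ⟩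
    weight j * lookup u (source j) + weight j * lookup w (source j) ≈⟨ +-cong (lookup-·M u j) (lookup-·M w j) ⟨
    lookup (u ·M) j + lookup (w ·M) j                              ≡⟨ lookup-+V (u ·M) (w ·M) j ⟨
    lookup ((u ·M) +V (w ·M)) j                                    ∎

  0V·M : 0V ·M ≋ 0V
  0V·M = ext λ j → begin
    lookup (0V ·M) j                ≈⟨ lookup-·M 0V j ⟩
    weight j * lookup 0V (source j) ≡⟨ ≡.cong (weight j *_) (lookup-0V (source j)) ⟩
    weight j * 0#                   ≈⟨ zeroʳ _ ⟩
    0#                              ≡⟨ lookup-0V j ⟨
    lookup 0V j                     ∎

  act-cong : ∀ k {u w} → u ≋ w → act k u ≋ act k w
  act-cong zero    u≋w = u≋w
  act-cong (suc k) u≋w = ·M-cong (act-cong k u≋w)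

  act-+V : ∀ k u w → act k (u +V w) ≋ act k u +V act k w
  act-+V zero    u w = ≋.refl
  act-+V (suc k) u w = ≋.trans (·M-cong (act-+V k u w)) (·M-+V (act k u) (act k w))

  act-0V : ∀ k → act k 0V ≋ 0V
  act-0V zero    = ≋.refl
  act-0V (suc k) = ≋.trans (·M-cong (act-0V k)) 0V·M

  act-+ : ∀ k l v → act k (act l v) ≡ act (k ℕ.+ l) v
  act-+ zero    l v = ≡.refl
  act-+ (suc k) l v = ≡.cong _·M (act-+ k l v)

  lookup-act-shift : ∀ k v i j → toℕ i ℕ.+ k ≡ toℕ j → lookup (act k v) j ≈ lookup v i
  lookup-act-shift zero    v i j i+0≡j =
    reflexive (≡.cong (lookup v) (Fin.toℕ-injective (≡.trans (≡.sym i+0≡j) (ℕ.+-identityʳ _))))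
  lookup-act-shift (suc k) v i Fin.zero i+k+1≡0 = ⊥-elim (ℕ.1+n≢0 (≡.trans (≡.sym (ℕ.+-suc (toℕ i) k)) i+k+1≡0))
  lookup-act-shift (suc k) v i (Fin.suc j) i+k+1≡j+1 = begin
    lookup (act k v ·M) (Fin.suc j)   ≈⟨ lookup-·M (act k v) (Fin.suc j) ⟩
    1# * lookup (act k v) (inject₁ j) ≈⟨ *-identityˡ _ ⟩
    lookup (act k v) (inject₁ j)      ≈⟨ lookup-act-shift k v i (inject₁ j) i+k≡j ⟩
    lookup v i                        ∎
    where
    i+k≡j : toℕ i ℕ.+ k ≡ toℕ (inject₁ j)
    i+k≡j = ≡.trans (ℕ.suc-injective (≡.trans (≡.sym (ℕ.+-suc (toℕ i) k)) i+k+1≡j+1)) (≡.sym (Fin.toℕ-inject₁ j))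

  lookup-act-wrap : ∀ k v i j → toℕ j ℕ.+ d ≡ toℕ i ℕ.+ k → lookup (act k v) j ≈ ω * lookup v i
  lookup-act-wrap zero v i j j+d≡i+0 = ⊥-elim (ℕ.<⇒≱ (Fin.toℕ<n i)
    (ℕ.≤-trans (ℕ.m≤n+m d (toℕ j)) (ℕ.≤-reflexive (≡.trans j+d≡i+0 (ℕ.+-identityʳ (toℕ i))))))
  lookup-act-wrap (suc k) v i Fin.zero d≡i+k+1 = begin
    lookup (act k v ·M) Fin.zero            ≈⟨ lookup-·M (act k v) Fin.zero ⟩
    ω * lookup (act k v) (fromℕ d-1)        ≈⟨ *-congˡ (lookup-act-shift k v i (fromℕ d-1) i+k≡d-1) ⟩
    ω * lookup v i                          ∎
    where
    i+k≡d-1 : toℕ i ℕ.+ k ≡ toℕ (fromℕ d-1)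
    i+k≡d-1 = ≡.trans (ℕ.suc-injective (≡.trans (≡.sym (ℕ.+-suc (toℕ i) k)) (≡.sym d≡i+k+1)))
      (≡.sym (Fin.toℕ-fromℕ d-1))
  lookup-act-wrap (suc k) v i (Fin.suc j) j+1+d≡i+k+1 = begin
    lookup (act k v ·M) (Fin.suc j)   ≈⟨ lookup-·M (act k v) (Fin.suc j) ⟩
    1# * lookup (act k v) (inject₁ j) ≈⟨ *-identityˡ _ ⟩
    lookup (act k v) (inject₁ j)      ≈⟨ lookup-act-wrap k v i (inject₁ j) j+d≡i+k ⟩
    ω * lookup v i                    ∎
    where
    j+d≡i+k : toℕ (inject₁ j) ℕ.+ d ≡ toℕ i ℕ.+ k
    j+d≡i+k = ≡.trans (≡.cong (ℕ._+ d) (Fin.toℕ-inject₁ j))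
      (ℕ.suc-injective (≡.trans j+1+d≡i+k+1 (ℕ.+-suc (toℕ i) k)))

  act-d : ∀ v → act d v ≋ ω *V v
  act-d v = ext λ j → trans (lookup-act-wrap d v j j ≡.refl) (sym (reflexive (lookup-*V ω v j)))

module HammingPowers (F : CommutativeRing 0ℓ 0ℓ) (d-1 n-1 : ℕ) (ω : CommutativeRing.Carrier F) where
  open CommutativeRing F using (Carrier; _≈_; 0#; 1#; +-congˡ)
    renaming (trans to ≈-trans; sym to ≈-sym; reflexive to ≈-reflexive)
  open HammingAction F d-1 n-1 ω
  open Hamming F d n ω
  open import Data.Nat using (_+_; _*_; _%_)
  open import Algebra.Properties.Semiring.Mult (CommutativeRing.semiring F) using () renaming (_×_ to _·_)
  open import Data.Nat.DivMod using (m%n<n; m<n⇒m%n≡m; %-distribˡ-+; m%n%n≡m%n)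
  open import Data.Nat.Divisibility using (_∣_; m%n≡0⇒n∣m; n∣m⇒m%n≡0)

  -- orbitSum a v N = v + v M^a + v M^2a + ⋯ + v M^(N-1)a, the V-part of (v x^a)^N
  orbitSum : ℕ → V → ℕ → V
  orbitSum a v zero    = 0V
  orbitSum a v (suc N) = v +V act a (orbitSum a v N)

  orbitSum-+ : ∀ a v N K → orbitSum a v (N + K) ≋ orbitSum a v N +V act (N * a) (orbitSum a v K)
  orbitSum-+ a v zero    K = ≋.sym (+V-identityˡ (orbitSum a v K))
  orbitSum-+ a v (suc N) K = begin
    v +V act a (orbitSum a v (N + K))                                      ≈⟨ +V-cong ≋.refl (act-cong a (orbitSum-+ a v N K)) ⟩
    v +V act a (orbitSum a v N +V act (N * a) (orbitSum a v K))            ≈⟨ +V-cong ≋.refl (act-+V a _ _) ⟩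
    v +V (act a (orbitSum a v N) +V act a (act (N * a) (orbitSum a v K)))  ≈⟨ +V-assoc _ _ _ ⟨
    orbitSum a v (suc N) +V act a (act (N * a) (orbitSum a v K))           ≡⟨ ≡.cong (orbitSum a v (suc N) +V_) (act-+ a (N * a) _) ⟩
    orbitSum a v (suc N) +V act (suc N * a) (orbitSum a v K)               ∎
    where open ≋-Reasoning

  orbitSum-1 : ∀ a v → orbitSum a v 1 ≋ v
  orbitSum-1 a v = ≋.trans (+V-cong ≋.refl (act-0V a)) (+V-identityʳ v)

  orbitSum-0V : ∀ a N → orbitSum a 0V N ≋ 0V
  orbitSum-0V a zero    = ≋.refl
  orbitSum-0V a (suc N) = ≋.trans (+V-identityˡ _) (≋.trans (act-cong a (orbitSum-0V a N)) (act-0V a))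

  orbitSum-fixed : ∀ a v N → act (N * a) v ≋ v → act a (orbitSum a v N) ≋ orbitSum a v N
  orbitSum-fixed a v N v-fixed = +V-cancelˡ v _ _ (begin
    orbitSum a v (suc N)                    ≡⟨ ≡.cong (orbitSum a v) (ℕ.+-comm 1 N) ⟩
    orbitSum a v (N + 1)                    ≈⟨ orbitSum-+ a v N 1 ⟩
    orbitSum a v N +V act (N * a) (orbitSum a v 1) ≈⟨ +V-cong ≋.refl (act-cong (N * a) (orbitSum-1 a v)) ⟩
    orbitSum a v N +V act (N * a) v         ≈⟨ +V-cong ≋.refl v-fixed ⟩
    orbitSum a v N +V v                     ≈⟨ +V-comm _ _ ⟩
    v +V orbitSum a v N                     ∎)
    where open ≋-Reasoning

  lookup-orbitSum-* : ∀ a v N → (∀ w → act (N * a) w ≋ w) →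
                      ∀ k j → lookup (orbitSum a v (k * N)) j ≈ k · lookup (orbitSum a v N) j
  lookup-orbitSum-* a v N period zero    j = ≈-reflexive (lookup-0V j)
  lookup-orbitSum-* a v N period (suc k) j = ≈-trans (Pointwise.app kN-step j) (≈-trans
    (≈-reflexive (lookup-+V (orbitSum a v N) (orbitSum a v (k * N)) j)) (+-congˡ (lookup-orbitSum-* a v N period k j)))
    where
    kN-step : orbitSum a v (suc k * N) ≋ orbitSum a v N +V orbitSum a v (k * N)
    kN-step = ≋.trans (orbitSum-+ a v N (k * N)) (+V-cong ≋.refl (period _))

  proj₁-powSuc : ∀ v g m → proj₁ (powSuc (v , g) m) ≋ orbitSum (toℕ g) v (suc m)
  proj₁-powSuc v g zero    = ≋.sym (orbitSum-1 (toℕ g) v)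
  proj₁-powSuc v g (suc m) = +V-cong ≋.refl (act-cong (toℕ g) (proj₁-powSuc v g m))

  toℕ-proj₂-powSuc : ∀ v g m → toℕ (proj₂ (powSuc (v , g) m)) ≡ (suc m * toℕ g) % n
  toℕ-proj₂-powSuc v g zero = ≡.sym (≡.trans (≡.cong (_% n) (ℕ.+-identityʳ (toℕ g))) (m<n⇒m%n≡m (Fin.toℕ<n g)))
  toℕ-proj₂-powSuc v g (suc m) = begin
    toℕ (g ⊕ proj₂ (powSuc (v , g) m))                  ≡⟨ Fin.toℕ-fromℕ< (m%n<n (toℕ g + toℕ (proj₂ (powSuc (v , g) m))) n) ⟩
    (toℕ g + toℕ (proj₂ (powSuc (v , g) m))) % n       ≡⟨ ≡.cong (λ r → (toℕ g + r) % n) (toℕ-proj₂-powSuc v g m) ⟩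
    (toℕ g + (suc m * toℕ g) % n) % n                  ≡⟨ %-distribˡ-+ (toℕ g) ((suc m * toℕ g) % n) n ⟩
    (toℕ g % n + (suc m * toℕ g) % n % n) % n          ≡⟨ ≡.cong (λ r → (toℕ g % n + r) % n) (m%n%n≡m%n (suc m * toℕ g) n) ⟩
    (toℕ g % n + (suc m * toℕ g) % n) % n              ≡⟨ %-distribˡ-+ (toℕ g) (suc m * toℕ g) n ⟨
    (suc (suc m) * toℕ g) % n                          ∎
    where open ≡.≡-Reasoning

  IsId-powSuc⇔ : ∀ v g m → IsId (powSuc (v , g) m) ⇔ (orbitSum (toℕ g) v (suc m) ≋ 0V × n ∣ suc m * toℕ g)
  IsId-powSuc⇔ v g m = mk⇔
    (λ (≈0 , ≡0) → ≋.trans (≋.sym (proj₁-powSuc v g m))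
                     (ext λ i → ≈-trans (≈0 i) (≈-sym (≈-reflexive (lookup-0V i))))
                 , m%n≡0⇒n∣m _ n (≡.trans (≡.sym (toℕ-proj₂-powSuc v g m)) ≡0))
    (λ (≋0 , n∣) → (λ i → ≈-trans (Pointwise.app (≋.trans (proj₁-powSuc v g m) ≋0) i) (≈-reflexive (lookup-0V i)))
                 , ≡.trans (toℕ-proj₂-powSuc v g m) (n∣m⇒m%n≡0 _ n n∣))

  IsId-powSuc-0V⇔ : ∀ g m → IsId (powSuc (0V , g) m) ⇔ n ∣ suc m * toℕ g
  IsId-powSuc-0V⇔ g m = mk⇔ (proj₂ ∘ Equivalence.to (IsId-powSuc⇔ 0V g m))
    (λ n∣ → Equivalence.from (IsId-powSuc⇔ 0V g m) (orbitSum-0V (toℕ g) (suc m) , n∣))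

module HammingOrders (F : CommutativeRing 0ℓ 0ℓ) {q-2 : ℕ} (isFF : IsFiniteField F (suc (suc q-2)))
                     (d-1 : ℕ) {ω : CommutativeRing.Carrier F} (gen : IsGenerator F ω) where
  open CommutativeRing F using (Carrier; _≈_; 0#; 1#)
    renaming (refl to ≈-refl; trans to ≈-trans; sym to ≈-sym; reflexive to ≈-reflexive)
  open import Data.Nat using (_+_; _*_)
  open import Algebra.Properties.Semiring.Exp (CommutativeRing.semiring F) using (_^_; ^-congˡ; ^-assocʳ)
  open import Algebra.Properties.Semiring.Mult (CommutativeRing.semiring F) using () renaming (_×_ to _·_)
  open FiniteFieldProperties F isFF
  open Generator gen

  q-1 n-1 : ℕ
  q-1 = suc q-2
  n-1 = q-2 + d-1 * q-1

  open HammingAction F d-1 n-1 ω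
  open HammingPowers F d-1 n-1 ω
  open Hamming F d n ω

  act-*d : ∀ t v → act (t * d) v ≋ ω ^ t *V v
  act-*d zero    v = ≋.sym (*V-identityˡ v)
  act-*d (suc t) v = begin
    act (d + t * d) v       ≡⟨ act-+ d (t * d) v ⟨
    act d (act (t * d) v)   ≈⟨ act-d (act (t * d) v) ⟩
    ω *V act (t * d) v      ≈⟨ *V-cong ≈-refl (act-*d t v) ⟩
    ω *V (ω ^ t *V v)       ≈⟨ *V-assoc ω (ω ^ t) v ⟩
    ω ^ suc t *V v          ∎
    where open ≋-Reasoning

  1^t≈1 : ∀ t → 1# ^ t ≈ 1#
  1^t≈1 = MonoidMultiples.·-ε (CommutativeRing.*-monoid F)

  act-period : ∀ {k} → n ∣ k → ∀ v → act k v ≋ v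
  act-period {k} (divides t ≡.refl) v = begin
    act (t * n) v                  ≡⟨ ≡.cong (λ e → act e v) t*n≡[q-1*t]*d ⟩
    act (q-1 * t * d) v            ≈⟨ act-*d (q-1 * t) v ⟩
    ω ^ (q-1 * t) *V v             ≈⟨ *V-cong ω^[q-1*t]≈1 ≋.refl ⟩
    1# *V v                        ≈⟨ *V-identityˡ v ⟩
    v                              ∎
    where
    open ≋-Reasoning
    t*n≡[q-1*t]*d : t * n ≡ q-1 * t * d
    t*n≡[q-1*t]*d = ≡.trans (ℕ.*-comm t (d * q-1)) (≡.trans (ℕ.*-assoc d q-1 t) (ℕ.*-comm d (q-1 * t)))
    ω^[q-1*t]≈1 : ω ^ (q-1 * t) ≈ 1#
    ω^[q-1*t]≈1 = ≈-trans (≈-sym (^-assocʳ ω q-1 t)) (≈-trans (^-congˡ t ω^[q-1]≈1) (1^t≈1 t))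

  act-fixed-* : ∀ a {X} → act a X ≋ X → ∀ k → act (k * a) X ≋ X
  act-fixed-* a     X-fixed zero    = ≋.refl
  act-fixed-* a {X} X-fixed (suc k) = ≋.trans (≋.reflexive (≡.sym (act-+ a (k * a) X)))
    (≋.trans (act-cong a (act-fixed-* a X-fixed k)) X-fixed)

  fixed⇒≋0V : ∀ a {X} → act a X ≋ X → ¬ ω ^ a ≈ 1# → X ≋ 0V
  fixed⇒≋0V a {X} X-fixed ω^a≉1 = ext λ j → ≈-trans
    (fixedBy≉1⇒≈0 ω^a≉1 (≈-trans (≈-sym (≈-reflexive (lookup-*V (ω ^ a) X j))) (Pointwise.app ω^a*X≋X j)))
    (≈-sym (≈-reflexive (lookup-0V j)))
    where
    ω^a*X≋X : ω ^ a *V X ≋ X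
    ω^a*X≋X = ≋.trans (≋.sym (act-*d a X))
      (≋.trans (≋.reflexive (≡.cong (λ e → act e X) (ℕ.*-comm a d))) (act-fixed-* a X-fixed d))

  ω^a≈1⇒n∣d*a : ∀ {a} → ω ^ a ≈ 1# → n ∣ d * a
  ω^a≈1⇒n∣d*a {a} ω^a≈1 = *-monoʳ-∣ d (ω^k≈1⇒q-1∣k a ω^a≈1)

  d-1<n-1 : 1 ≤ q-2 → d-1 < n-1
  d-1<n-1 1≤q-2 = ℕ.+-mono-≤ 1≤q-2 (ℕ.m≤m*n d-1 q-1)

  order-g⇒order-vg : 1 ≤ q-2 → ∀ v g → HasOrder n (0V , g) → HasOrder n (v , g)
  order-g⇒order-vg 1≤q-2 v g (_ , g-order) =
    Equivalence.from (IsId-powSuc⇔ v g n-1) (orbitSum≋0V , m∣m*n a) ,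
    λ j j<n-1 → g-order j j<n-1 ∘ Equivalence.from (IsId-powSuc-0V⇔ g j) ∘ proj₂ ∘ Equivalence.to (IsId-powSuc⇔ v g j)
    where
    a : ℕ
    a = toℕ g
    ω^a≉1 : ¬ ω ^ a ≈ 1#
    ω^a≉1 = g-order d-1 (d-1<n-1 1≤q-2) ∘ Equivalence.from (IsId-powSuc-0V⇔ g d-1) ∘ ω^a≈1⇒n∣d*a
    orbitSum≋0V : orbitSum a v n ≋ 0V
    orbitSum≋0V = fixed⇒≋0V a (orbitSum-fixed a v n (act-period (m∣m*n a) v)) ω^a≉1

  nonzeroCoordinate : ∀ {Y} → ¬ Y ≋ 0V → ∃ λ j → ¬ lookup Y j ≈ 0#
  nonzeroCoordinate {Y} Y≉0 = Fin.¬∀⟶∃¬ d _ (λ j → lookup Y j ≈? 0#)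
    λ Y≈0 → Y≉0 (ext λ j → ≈-trans (Y≈0 j) (≈-sym (≈-reflexive (lookup-0V j))))

  module FromOrderOfVg (1≤q-2 : 1 ≤ q-2) (v : V) (g : Fin n) (vg-order : HasOrder n (v , g)) where
    a : ℕ
    a = toℕ g

    vg-proper : ∀ j → j < n-1 → ¬ (orbitSum a v (suc j) ≋ 0V × n ∣ suc j * a)
    vg-proper j j<n-1 = proj₂ vg-order j j<n-1 ∘ Equivalence.from (IsId-powSuc⇔ v g j)

    orbitSum-n≋0V : orbitSum a v n ≋ 0V
    orbitSum-n≋0V = proj₁ (Equivalence.to (IsId-powSuc⇔ v g n-1) (proj₁ vg-order))

    -- N₀ = suc m is the order of g.
    module LeastPeriod {m : ℕ} (m<n-1 : m < n-1) (least : IsLeast (λ k → n ∣ suc k * a) m) where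
      N₀ : ℕ
      N₀ = suc m

      Y : V
      Y = orbitSum a v N₀

      act-N₀*a : ∀ w → act (N₀ * a) w ≋ w
      act-N₀*a = act-period (proj₁ least)

      Y≉0V : ¬ Y ≋ 0V
      Y≉0V Y≋0V = vg-proper m m<n-1 (Y≋0V , proj₁ least)

      ω^a≈1 : ω ^ a ≈ 1#
      ω^a≈1 = decidable-stable (ω ^ a ≈? 1#) (Y≉0V ∘ fixed⇒≋0V a (orbitSum-fixed a v N₀ (act-N₀*a v)))

      N₀∣d : N₀ ∣ d
      N₀∣d = leastPeriod-∣ least (ω^a≈1⇒n∣d*a ω^a≈1)

      module _ (Q : ℕ) (d≡QN₀ : d ≡ Q * N₀) where
        c : ℕ
        c = Q * q-1

        n≡cN₀ : n ≡ c * N₀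
        n≡cN₀ = ≡.trans (≡.cong (_* q-1) d≡QN₀) (≡.trans (ℕ.*-assoc Q N₀ q-1)
          (≡.trans (≡.cong (Q *_) (ℕ.*-comm N₀ q-1)) (≡.sym (ℕ.*-assoc Q q-1 N₀))))

        c·1≈0 : c · 1# ≈ 0#
        c·1≈0 with nonzeroCoordinate Y≉0V
        ... | j , Yj≉0 = ·≈0⇒·1≈0 c Yj≉0 (begin
          c · lookup Y j                     ≈⟨ lookup-orbitSum-* a v N₀ act-N₀*a c j ⟨
          lookup (orbitSum a v (c * N₀)) j   ≡⟨ ≡.cong (λ N → lookup (orbitSum a v N) j) n≡cN₀ ⟨
          lookup (orbitSum a v n) j          ≈⟨ Pointwise.app orbitSum-n≋0V j ⟩
          lookup 0V j                        ≡⟨ lookup-0V j ⟩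
          0#                                 ∎)
          where open import Relation.Binary.Reasoning.Setoid (CommutativeRing.setoid F)

        c-least : ∀ k → 0 < k → k < c → ¬ k · 1# ≈ 0#
        c-least (suc k) _ k<c k·1≈0 = vg-proper (m + k * N₀) (ℕ.≤-pred kN₀<n) (orbitSum≋0V , n∣kN₀a)
          where
          kN₀<n : suc k * N₀ < n
          kN₀<n = ≡.subst (suc k * N₀ <_) (≡.sym n≡cN₀) (ℕ.*-monoˡ-< N₀ k<c)
          orbitSum≋0V : orbitSum a v (suc k * N₀) ≋ 0V
          orbitSum≋0V = ext λ i → ≈-trans (lookup-orbitSum-* a v N₀ act-N₀*a (suc k) i)
            (≈-trans (·1≈0⇒·≈0 (suc k) k·1≈0 (lookup Y i)) (≈-sym (≈-reflexive (lookup-0V i))))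
          n∣kN₀a : n ∣ suc k * N₀ * a
          n∣kN₀a = ≡.subst (n ∣_) (≡.sym (ℕ.*-assoc (suc k) N₀ a)) (∣n⇒∣m*n (suc k) (proj₁ least))

      absurd : ⊥
      absurd with N₀∣d
      ... | divides zero    ()
      ... | divides (suc Q) d≡[1+Q]N₀ = additiveOrder≢[1+Q]*[q-1] (s≤s 1≤q-2) Q ≡.refl
        where open AdditiveOrderOfOne (c·1≈0 (suc Q) d≡[1+Q]N₀) (c-least (suc Q) d≡[1+Q]N₀)

    no-earlier-period : ∀ j → j < n-1 → ¬ n ∣ suc j * a
    no-earlier-period j j<n-1 n∣[1+j]a with leastWitness (λ k → n ∣? suc k * a) n∣[1+j]a
    ... | m , m≤j , least = LeastPeriod.absurd (ℕ.≤-<-trans m≤j j<n-1) least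

    g-order : HasOrder n (0V , g)
    g-order = Equivalence.from (IsId-powSuc-0V⇔ g n-1) (m∣m*n a) ,
      λ j j<n-1 → no-earlier-period j j<n-1 ∘ Equivalence.to (IsId-powSuc-0V⇔ g j)

  order-vg⇒order-g : 1 ≤ q-2 → ∀ v g → HasOrder n (v , g) → HasOrder n (0V , g)
  order-vg⇒order-g = FromOrderOfVg.g-order

open import Data.Nat using (_*_; _∸_)

corollary8p2 : (R : CommutativeRing 0ℓ 0ℓ) (q : ℕ) → IsFiniteField R q → IsPrimePower q → 2 < q →
               (d : ℕ) → 1 ≤ d → (ω : CommutativeRing.Carrier R) → IsGenerator R ω →
               (v : Vec (CommutativeRing.Carrier R) d) (g : Fin (d * (q ∸ 1))) →
               Hamming.HasOrder R d (d * (q ∸ 1)) ω (d * (q ∸ 1)) (v , g)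
                 ⇔ Hamming.HasOrder R d (d * (q ∸ 1)) ω (d * (q ∸ 1)) (Hamming.0V R d (d * (q ∸ 1)) ω , g)
corollary8p2 R (suc (suc q-2)) isFF _ (s≤s (s≤s 1≤q-2)) (suc d-1) (s≤s z≤n) ω gen v g =
  mk⇔ (order-vg⇒order-g 1≤q-2 v g) (order-g⇒order-vg 1≤q-2 v g)
  where open HammingOrders R isFF d-1 gen
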